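{- For every finite graph $G$, in the connected component game on $G$ player 2 has a strategy guaranteeing that the result of the game is at most $\chi_{um}(G)$; that is, $v_{cs}(G)\le\chi_{um}(G)$.
   Context: For a vertex set $V'$, $G[V']$ is the induced subgraph. The connected component game on $G$: set $i=0$, $G^0=G$; while $V(G^i)\neq\emptyset$: increase $i$ by 1, player 1 chooses (the vertex set $S^i$ of) a connected component of $G^{i-1}$, player 2 chooses a vertex $v_i\in S^i$, and $G^i=G^{i-1}[S^i\setminus\{v_i\}]$. The result is the final value of $i$; player 1 maximizes it and player 2 minimizes it, and $v_{cs}(G)$ is the result under optimal play by both. A path is a simple path (a single vertex counts). A unique-maximum coloring with $k$ colors is a map $V(G)\to\{1,\dots,k\}$ such that on every path the maximum color occurs exactly once; $\chi_{um}(G)$ is the minimum such $k$ ($0$ for the empty graph). -}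

module Defs where

open import Data.Nat using (ℕ; zero; suc; _≤_)
open import Data.Fin using (Fin) renaming (_<_ to _<ᶠ_)
open import Data.Fin.Subset using (Subset; _∈_; _⊆_; _-_; Nonempty; Empty; ⊤)
open import Data.List using (List; _∷_)
open import Data.List.Relation.Unary.Linked using (Linked)
open import Data.List.Relation.Unary.Unique.Propositional using (Unique)
import Data.List.Membership.Propositional as LM
open import Data.Product using (Σ; ∃; _×_; _,_)
open import Relation.Binary.PropositionalEquality using (_≡_; _≢_)
open import Relation.Nullary using (¬_)

record Graph : Set₁ where
  field
    n      : ℕ
    Adj    : Fin n → Fin n → Set
    sym    : ∀ {u v} → Adj u v → Adj v u
    irrefl : ∀ {u} → ¬ Adj u u

open Graph public

module _ (G : Graph) where

  data Reach (S : Subset (n G)) : Fin (n G) → Fin (n G) → Set where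
    here : ∀ {u} → Reach S u u
    step : ∀ {u w v} → Adj G u w → w ∈ S → Reach S w v → Reach S u v

  IsComponent : Subset (n G) → Subset (n G) → Set
  IsComponent W S =
    S ⊆ W × Nonempty S
    × (∀ {u v} → u ∈ S → v ∈ S → Reach S u v)
    × (∀ {u w} → u ∈ S → w ∈ W → Adj G u w → w ∈ S)

  -- Player 2 can guarantee that the connected component game played
  -- on G[W] lasts at most k rounds.
  data P2Guarantees : Subset (n G) → ℕ → Set where
    done  : ∀ {W k} → Empty W → P2Guarantees W k
    round : ∀ {W k} →
            (∀ S → IsComponent W S →
               Σ (Fin (n G)) λ v → v ∈ S × P2Guarantees (S - v) k) →
            P2Guarantees W (suc k)

  record Path : Set where
    constructor mkPath
    field
      start  : Fin (n G)
      rest   : List (Fin (n G))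
      linked : Linked (Adj G) (start ∷ rest)
      unique : Unique (start ∷ rest)

  vertices : Path → List (Fin (n G))
  vertices p = Path.start p ∷ Path.rest p

  -- Unique-maximum colouring with k colours (colours {1..k} represented by Fin k).
  IsUMColoring : (k : ℕ) → (Fin (n G) → Fin k) → Set
  IsUMColoring k c = ∀ (p : Path) →
    ∃ λ v → v LM.∈ vertices p × (∀ u → u LM.∈ vertices p → u ≢ v → c u <ᶠ c v)

  HasUMColoring : ℕ → Set
  HasUMColoring k = ∃ λ (c : Fin (n G) → Fin k) → IsUMColoring k c

  IsChiUM : ℕ → Set
  IsChiUM k = HasUMColoring k × (∀ j → HasUMColoring j → k ≤ j)

-- Player 2 always deletes a vertex of maximum colour in the component chosen by
-- player 1. In a connected set S with colour maximum v every other vertex u has a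
-- strictly smaller colour: on a simple path from u to v inside S the unique maximum
-- cannot be u (v is at least as large), so u lies strictly below it and hence below
-- v. Thus the colours left after a round are below the colour just deleted, and with
-- colours 1, …, k the game ends after at most k rounds.
module Submission where

open import Defs
open import Data.Nat using (ℕ; zero; suc; _≤_; _<_; s≤s⁻¹)
open import Data.Nat.Properties using (<-≤-trans; <-irrefl; n≮0)
open import Data.Fin using (Fin; toℕ; _≟_) renaming (_≤_ to _≤ᶠ_; _<_ to _<ᶠ_)
open import Data.Fin.Properties using (toℕ<n)
open import Data.Fin.Subset using (Subset; outside; _─_; _-_; ⁅_⁆; Nonempty; ⊤) renaming (_∈_ to _∈ₛ_; _∉_ to _∉ₛ_)
open import Data.Fin.Subset.Properties using (p─q⊆p; x∈⁅x⁆) renaming (_∈?_ to _∈ₛ?_)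
open import Data.Vec.Base using (_∷_; here; there)
open import Data.List using (List; []; _∷_; allFin; filter)
open import Data.List.Relation.Unary.Linked using (Linked; [-]; _∷_) renaming (tail to Linked-tail)
open import Data.List.Relation.Unary.All using (All; []; _∷_; lookup)
open import Data.List.Relation.Unary.All.Properties using (¬Any⇒All¬; all-filter)
open import Data.List.Relation.Unary.Any using (here; there)
open import Data.List.Relation.Unary.AllPairs using ([]; _∷_)
open import Data.List.Relation.Unary.Unique.Propositional using (Unique)
open import Data.List.Membership.Propositional using (_∈_)
open import Data.List.Membership.Propositional.Properties using (∈-allFin; ∈-filter⁺)
import Data.List.Membership.DecPropositional as DecMembership
open import Data.List.Extrema.Nat using (argmax; argmax-all; f[xs]≤f[argmax])
open import Data.Product using (∃-syntax; _×_; _,_)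
open import Data.Empty using (⊥-elim)
open import Function using (_∘_)
open import Relation.Binary.PropositionalEquality using (_≢_; refl) renaming (sym to ≡-sym)
open import Relation.Nullary using (yes; no)

x∈p─q⇒x∉q : ∀ {n} (p q : Subset n) {x : Fin n} → x ∈ₛ p ─ q → x ∉ₛ q
x∈p─q⇒x∉q (_ ∷ p) (outside ∷ q) here        ()
x∈p─q⇒x∉q (_ ∷ p) (_ ∷ q)       (there x∈) (there x∈q) = x∈p─q⇒x∉q p q x∈ x∈q

x∈p-y⇒x≢y : ∀ {n} (p : Subset n) {x y : Fin n} → x ∈ₛ p - y → x ≢ y
x∈p-y⇒x≢y p {y = y} x∈p-y refl = x∈p─q⇒x∉q p ⁅ y ⁆ x∈p-y (x∈⁅x⁆ y)

∃-maximum : ∀ {n} (f : Fin n → ℕ) {S : Subset n} → Nonempty S →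
            ∃[ v ] v ∈ₛ S × (∀ {u} → u ∈ₛ S → f u ≤ f v)
∃-maximum {n} f {S} (w , w∈S) =
  argmax f w members , argmax-all f w∈S (all-filter (_∈ₛ? S) (allFin n)) , f≤max
  where
  members : List (Fin n)
  members = filter (_∈ₛ? S) (allFin n)
  f≤max : ∀ {u} → u ∈ₛ S → f u ≤ f (argmax f w members)
  f≤max u∈S = lookup (f[xs]≤f[argmax] w members) (∈-filter⁺ (_∈ₛ? S) (∈-allFin _) u∈S)

data Last {A : Set} (v : A) : List A → Set where
  end : Last v (v ∷ [])
  _∷_ : ∀ x {xs} → Last v xs → Last v (x ∷ xs)

Last⇒∈ : ∀ {A : Set} {v : A} {xs} → Last v xs → v ∈ xs
Last⇒∈ end        = here refl
Last⇒∈ (_ ∷ last) = there (Last⇒∈ last)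

module _ (G : Graph) where
  private
    V : Set
    V = Fin (n G)

  open DecMembership (_≟_ {n G}) using () renaming (_∈?_ to _∈ₗ?_)

  record SimplePath (S : Subset (n G)) (u v : V) : Set where
    field
      rest   : List V
      linked : Linked (Adj G) (u ∷ rest)
      unique : Unique (u ∷ rest)
      inside : All (_∈ₛ S) (u ∷ rest)
      last   : Last v (u ∷ rest)

    path : Path G
    path = mkPath u rest linked unique

  open SimplePath

  suffixFrom : ∀ {S u v} xs → u ∈ xs → Linked (Adj G) xs → Unique xs →
               All (_∈ₛ S) xs → Last v xs → SimplePath S u v
  suffixFrom (_ ∷ xs) (here refl) linked unique inside last =
    record { rest = xs ; linked = linked ; unique = unique ; inside = inside ; last = last }
  suffixFrom (_ ∷ xs) (there u∈xs) linked (_ ∷ unique) (_ ∷ inside) (_ ∷ last) =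
    suffixFrom xs u∈xs (Linked-tail linked) unique inside last
  suffixFrom (_ ∷ []) (there ()) _ _ _ end

  -- Loop erasure: if u recurs on the erased remainder of the walk, cut back to that occurrence.
  Reach⇒SimplePath : ∀ {S u v} → u ∈ₛ S → Reach G S u v → SimplePath S u v
  Reach⇒SimplePath {u = u} u∈S here =
    record { rest = [] ; linked = [-] ; unique = [] ∷ [] ; inside = u∈S ∷ [] ; last = end }
  Reach⇒SimplePath {u = u} u∈S (step {w = w} u~w w∈S reach)
    with Reach⇒SimplePath w∈S reach
  ... | record { rest = rest ; linked = linked ; unique = unique ; inside = inside ; last = last }
    with u ∈ₗ? (w ∷ rest)
  ...   | yes u∈path = suffixFrom (w ∷ rest) u∈path linked unique inside last
  ...   | no  u∉path = record
    { rest   = w ∷ rest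
    ; linked = u~w ∷ linked
    ; unique = ¬Any⇒All¬ (w ∷ rest) u∉path ∷ unique
    ; inside = u∈S ∷ inside
    ; last   = u ∷ last
    }

  module _ {k : ℕ} {c : V → Fin k} (isUM : IsUMColoring G k c) where

    SimplePath⇒<-max : ∀ {S u v} → SimplePath S u v → (∀ {x} → x ∈ₛ S → c x ≤ᶠ c v) →
                       u ≢ v → c u <ᶠ c v
    SimplePath⇒<-max {S} {u} {v} p cv-max u≢v with isUM (path p)
    ... | w , w∈p , w-unique-max with u ≟ w
    ...   | no  u≢w  =
      <-≤-trans (w-unique-max u (here refl) u≢w) (cv-max (lookup (inside p) w∈p))
    ...   | yes refl = ⊥-elim (<-irrefl refl
      (<-≤-trans (w-unique-max v (Last⇒∈ (last p)) (u≢v ∘ ≡-sym))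
                 (cv-max (lookup (inside p) (here refl)))))

    <-max-of-connected : ∀ {S v} → (∀ {x y} → x ∈ₛ S → y ∈ₛ S → Reach G S x y) → v ∈ₛ S →
                         (∀ {x} → x ∈ₛ S → c x ≤ᶠ c v) → ∀ {u} → u ∈ₛ S - v → c u <ᶠ c v
    <-max-of-connected {S} {v} connected v∈S cv-max u∈S-v =
      SimplePath⇒<-max (Reach⇒SimplePath u∈S (connected u∈S v∈S)) cv-max (x∈p-y⇒x≢y S u∈S-v)
      where u∈S = p─q⊆p S ⁅ v ⁆ u∈S-v

    colours<⇒P2Guarantees : ∀ m W → (∀ {u} → u ∈ₛ W → toℕ (c u) < m) → P2Guarantees G W m
    colours<⇒P2Guarantees zero    W colours<0 = done λ (u , u∈W) → n≮0 (colours<0 u∈W)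
    colours<⇒P2Guarantees (suc m) W colours≤m = round deleteMax
      where
      deleteMax : ∀ S → IsComponent G W S → ∃[ v ] v ∈ₛ S × P2Guarantees G (S - v) m
      deleteMax S (S⊆W , nonempty , connected , _) with ∃-maximum (toℕ ∘ c) nonempty
      ... | v , v∈S , cv-max = v , v∈S , colours<⇒P2Guarantees m (S - v) λ u∈S-v →
              <-≤-trans (<-max-of-connected connected v∈S cv-max u∈S-v)
                        (s≤s⁻¹ (colours≤m (S⊆W v∈S)))

proposition5 : (G : Graph) (k : ℕ) → IsChiUM G k → P2Guarantees G ⊤ k
proposition5 G k ((c , isUM) , _) = colours<⇒P2Guarantees G isUM k ⊤ (λ {u} _ → toℕ<n (c u))
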